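{- Let $d\ge 1$ and $r\ge d$ be integers, and let $x_1,\dots,x_d$ be nonnegative integers with $x_1+\cdots+x_d=r$. Let $C$ be a set of $r$ vertices. For a simple graph $G$ on vertex set $C$, let $S(G)$ (the "sun" centered at $G$) be the graph obtained from $G$ by attaching to each vertex of $C$ one new pendant edge, the $r$ pendant edges having distinct new end vertices. Fix a coloring of the $r$ pendant edges with colors $1,\dots,d$ in which exactly $x_i$ pendant edges receive color $i$ for each $i$. Then there exists a $(d-1)$-regular simple graph $G$ on $C$ such that this coloring of the pendant edges extends to a proper edge coloring of $S(G)$ with the $d$ colors $1,\dots,d$ (equivalently, $S(G)$ is class I with the given pendant colors) if and only if $x_1,\dots,x_d$ and $r$ all have the same parity and, in case this common parity is odd, $d$ is also odd. If the condition fails, no $(d-1)$-regular simple graph $G$ on $C$ has this property.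
   Context: A proper edge coloring assigns colors to edges so that edges sharing an end vertex get different colors. A multigraph is called class I if its chromatic index (minimum number of colors in a proper edge coloring) equals its maximum valency. Note that for $(d-1)$-regular $G$, the graph $S(G)$ has maximum valency $d$. -}

module Defs where

open import Data.Nat using (ℕ; zero; suc; _+_)
open import Data.Bool using (Bool; true; false; if_then_else_)
open import Data.Fin using (Fin; zero; suc)
open import Data.Fin.Properties using (_≟_)
open import Relation.Nullary using (¬_)
open import Relation.Nullary.Decidable using (⌊_⌋)
open import Relation.Binary.PropositionalEquality using (_≡_; _≢_)

count : ∀ {n} → (Fin n → Bool) → ℕ
count {zero}  P = 0
count {suc n} P = (if P zero then 1 else 0) + count (λ i → P (suc i))

sumFin : ∀ {n} → (Fin n → ℕ) → ℕ
sumFin {zero}  f = 0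
sumFin {suc n} f = f zero + sumFin (λ i → f (suc i))

record SimpleGraph (n : ℕ) : Set where
  field
    adj   : Fin n → Fin n → Bool
    sym   : ∀ u v → adj u v ≡ adj v u
    irrefl : ∀ v → adj v v ≡ false
open SimpleGraph public

degree : ∀ {n} → SimpleGraph n → Fin n → ℕ
degree G v = count (adj G v)

Regular : ∀ {n} → ℕ → SimpleGraph n → Set
Regular k G = ∀ v → degree G v ≡ k

colourClassSize : ∀ {r d} → (Fin r → Fin d) → Fin d → ℕ
colourClassSize p i = count (λ v → ⌊ p v ≟ i ⌋)

-- A proper edge colouring of the sun S(G) with colours Fin d, extending the
-- pendant colouring p (pendant edge at v gets colour p v).  The colour of the
-- G-edge uv is col u v (= col v u); values on non-edges are irrelevant.
-- Pendant leaves have valency 1, so the only constraints are at vertices of C.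
record SunColouring {r d : ℕ} (G : SimpleGraph r) (p : Fin r → Fin d) : Set where
  field
    col      : Fin r → Fin r → Fin d
    col-sym  : ∀ u v → adj G u v ≡ true → col u v ≡ col v u
    proper   : ∀ v u w → adj G v u ≡ true → adj G v w ≡ true → u ≢ w →
               col v u ≢ col v w
    pendant  : ∀ v u → adj G v u ≡ true → col v u ≢ p v

-- A colouring of S(G) as required is the same as a family of pairwise disjoint matchings M_j
-- (the G-edges of colour j) such that M_j is a perfect matching of the vertices whose pendant
-- edge is not coloured j: by (d - 1)-regularity each vertex sees every other colour.  So r - x_j is even for every j; if r is odd, all x_j are odd and
-- d ≡ x_1 + ... + x_d = r is odd.
--
-- Conversely, lay the colour classes out as consecutive blocks of the positions 0, ..., r - 1.
-- For odd r, let M_j pair a with b when a + b ≡ 2c_j (mod r), c_j the centre of block j; this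
-- matches block j to itself by reflection, so M_j matches the other vertices among themselves.
-- For even r = n + 1, position 0 plays ∞ in the 1-factorisation of K_{n+1} over ℤ_n: every
-- colour other than that of the block j₀ containing 0 gets its own 1-factor (there are enough
-- since d ≤ r), chosen to match its block to itself by reflection, and M_{j₀} consists of the
-- reflection pairs of all the other blocks.  Relabelling the positions inside each colour class
-- carries this over to the given colouring.

module Submission where

open import Defs hiding (sym)
open import Data.Bool using (Bool; true; false; if_then_else_; _∧_; _∨_; not)
open import Data.Bool.Properties using (not-injective; T-≡)
open import Data.Empty using (⊥; ⊥-elim)
open import Data.Fin using (Fin; zero; suc; toℕ; fromℕ<)
import Data.Fin as Fin
open import Data.Fin.Properties using (_≟_; suc-injective; toℕ<n; toℕ-fromℕ<; toℕ-injective)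
import Data.Fin.Properties as Fin
open import Data.Nat using (ℕ; zero; suc; _+_; _*_; _∸_; _≤_; _<_; z≤n; s≤s; _%_; _/_; NonZero; ≢-nonZero; _≤ᵇ_; _<ᵇ_; _<?_)
open import Data.Nat.Properties hiding (suc-injective) renaming (_≟_ to _≟ℕ_)
open import Data.Nat.DivMod
open import Data.Nat.Solver using (module +-*-Solver)
open import Data.Product using (Σ; _×_; _,_; proj₁; proj₂)
open import Data.Sum using (_⊎_; inj₁; inj₂)
open import Function using (id)
open import Function.Bundles using (_⇔_; mk⇔; Equivalence)
open import Relation.Binary.Definitions using (tri<; tri≈; tri>)
open import Relation.Nullary using (¬_; Dec; yes; no)
open import Relation.Nullary.Decidable using (⌊_⌋; isYes≗does; dec-true; dec-false)
open import Relation.Binary.PropositionalEquality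

open +-*-Solver

true≢false : ∀ {a} → a ≡ true → a ≡ false → ⊥
true≢false refl ()

∧-true : ∀ {a b} → a ≡ true → b ≡ true → (a ∧ b) ≡ true
∧-true refl refl = refl

∧-trueˡ : ∀ a {b} → (a ∧ b) ≡ true → a ≡ true
∧-trueˡ true _ = refl

∧-trueʳ : ∀ a {b} → (a ∧ b) ≡ true → b ≡ true
∧-trueʳ true e = e

bool-ext : ∀ {a b} → (a ≡ true → b ≡ true) → (b ≡ true → a ≡ true) → a ≡ b
bool-ext {true}  {true}  _ _ = refl
bool-ext {true}  {false} f _ = sym (f refl)
bool-ext {false} {true}  _ g = g refl
bool-ext {false} {false} _ _ = refl

⌊⌋-yes : ∀ {A : Set} (a? : Dec A) → A → ⌊ a? ⌋ ≡ true
⌊⌋-yes a? a = trans (isYes≗does a?) (dec-true a? a)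

⌊⌋-no : ∀ {A : Set} (a? : Dec A) → ¬ A → ⌊ a? ⌋ ≡ false
⌊⌋-no a? ¬a = trans (isYes≗does a?) (dec-false a? ¬a)

⌊⌋-true⇒ : ∀ {A : Set} {a? : Dec A} → ⌊ a? ⌋ ≡ true → A
⌊⌋-true⇒ {a? = yes a} _ = a

⌊⌋-false⇒ : ∀ {A : Set} {a? : Dec A} → not ⌊ a? ⌋ ≡ true → ¬ A
⌊⌋-false⇒ {a? = no ¬a} _ = ¬a

infix 4 _==_
_==_ : ∀ {n} → Fin n → Fin n → Bool
i == j = ⌊ i ≟ j ⌋

==-refl : ∀ {n} (i : Fin n) → (i == i) ≡ true
==-refl i = ⌊⌋-yes (i ≟ i) refl

==⇒≡ : ∀ {n} {i j : Fin n} → (i == j) ≡ true → i ≡ j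
==⇒≡ = ⌊⌋-true⇒

≢⇒not== : ∀ {n} {i j : Fin n} → i ≢ j → not (i == j) ≡ true
≢⇒not== {i = i} {j} i≢j = cong not (⌊⌋-no (i ≟ j) i≢j)

not==⇒≢ : ∀ {n} {i j : Fin n} → not (i == j) ≡ true → i ≢ j
not==⇒≢ = ⌊⌋-false⇒

count-cong : ∀ {n} {P Q : Fin n → Bool} → (∀ i → P i ≡ Q i) → count P ≡ count Q
count-cong {zero}  _ = refl
count-cong {suc n} {P} P≗Q rewrite P≗Q zero = cong (_ +_) (count-cong (λ i → P≗Q (suc i)))

count-false : ∀ {n} (P : Fin n → Bool) → (∀ i → P i ≡ false) → count P ≡ 0
count-false {zero}  P _ = refl
count-false {suc n} P P≡false rewrite P≡false zero = count-false _ (λ i → P≡false (suc i))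

count-== : ∀ {n} (c : Fin n) → count (c ==_) ≡ 1
count-== {suc n} zero = cong suc (count-false {n} _ (λ _ → refl))
count-== {suc n} (suc c) = trans (count-cong (λ i → shift i)) (count-== c)
  where
  shift : ∀ i → (suc c == suc i) ≡ (c == i)
  shift i with c ≟ i
  ... | yes _ = refl
  ... | no  _ = refl

count-∨ : ∀ {n} (P Q : Fin n → Bool) → (∀ i → P i ≡ true → Q i ≡ true → ⊥) →
          count (λ i → P i ∨ Q i) ≡ count P + count Q
count-∨ {zero}  P Q _ = refl
count-∨ {suc n} P Q disjoint with P zero in P0 | Q zero in Q0
... | true  | true  = ⊥-elim (disjoint zero P0 Q0)
... | true  | false = cong suc (count-∨ _ _ (λ i → disjoint (suc i)))
... | false | true  = trans (cong suc (count-∨ _ _ (λ i → disjoint (suc i)))) (sym (+-suc _ _))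
... | false | false = count-∨ _ _ (λ i → disjoint (suc i))

count-+-count-not : ∀ {n} (P : Fin n → Bool) → count P + count (λ i → not (P i)) ≡ n
count-+-count-not {zero}  P = refl
count-+-count-not {suc n} P with P zero
... | true  = cong suc (count-+-count-not _)
... | false = trans (+-suc _ _) (cong suc (count-+-count-not _))

count-not-== : ∀ {n} (c : Fin n) → count (λ j → not (c == j)) ≡ n ∸ 1
count-not-== {n} c = begin
  count (λ j → not (c == j))                      ≡⟨ sym (m+n∸m≡n 1 _) ⟩
  1 + count (λ j → not (c == j)) ∸ 1              ≡⟨ cong (λ k → k + count (λ j → not (c == j)) ∸ 1) (sym (count-== c)) ⟩
  count (c ==_) + count (λ j → not (c == j)) ∸ 1  ≡⟨ cong (_∸ 1) (count-+-count-not (c ==_)) ⟩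
  n ∸ 1                                           ∎
  where open ≡-Reasoning

count-mono : ∀ {n} (P Q : Fin n → Bool) → (∀ i → P i ≡ true → Q i ≡ true) → count P ≤ count Q
count-mono {zero}  P Q _ = z≤n
count-mono {suc n} P Q P⊆Q with P zero in P0 | Q zero in Q0
... | true  | true  = s≤s (count-mono _ _ (λ i → P⊆Q (suc i)))
... | true  | false = ⊥-elim (true≢false (P⊆Q zero P0) Q0)
... | false | true  = m≤n⇒m≤1+n (count-mono _ _ (λ i → P⊆Q (suc i)))
... | false | false = count-mono _ _ (λ i → P⊆Q (suc i))

count-mono-< : ∀ {n} (P Q : Fin n → Bool) → (∀ i → P i ≡ true → Q i ≡ true) →
               ∀ j → P j ≡ false → Q j ≡ true → count P < count Q
count-mono-< {suc n} P Q P⊆Q zero Pj Qj rewrite Pj | Qj = s≤s (count-mono _ _ (λ i → P⊆Q (suc i)))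
count-mono-< {suc n} P Q P⊆Q (suc j) Pj Qj with P zero in P0 | Q zero in Q0
... | true  | true  = s≤s (count-mono-< _ _ (λ i → P⊆Q (suc i)) j Pj Qj)
... | true  | false = ⊥-elim (true≢false (P⊆Q zero P0) Q0)
... | false | true  = m<n⇒m<1+n (count-mono-< _ _ (λ i → P⊆Q (suc i)) j Pj Qj)
... | false | false = count-mono-< _ _ (λ i → P⊆Q (suc i)) j Pj Qj

count>0⇒witness : ∀ {n} (P : Fin n → Bool) → 0 < count P → Σ (Fin n) λ i → P i ≡ true
count>0⇒witness {suc n} P pos with P zero in P0
... | true  = zero , P0
... | false with count>0⇒witness (λ i → P (suc i)) pos
...   | i , Pi = suc i , Pi

count-remove : ∀ {n} (P : Fin n → Bool) c → P c ≡ true →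
               count P ≡ suc (count (λ i → P i ∧ not (c == i)))
count-remove P c Pc =
  trans (count-cong split)
        (trans (count-∨ (c ==_) (λ i → P i ∧ not (c == i)) disjoint)
               (cong (_+ count (λ i → P i ∧ not (c == i))) (count-== c)))
  where
  split : ∀ i → P i ≡ ((c == i) ∨ (P i ∧ not (c == i)))
  split i with c ≟ i
  ... | yes refl = Pc
  ... | no  _ with P i
  ...   | true  = refl
  ...   | false = refl
  disjoint : ∀ i → (c == i) ≡ true → (P i ∧ not (c == i)) ≡ true → ⊥
  disjoint i c==i rest = not==⇒≢ (∧-trueʳ (P i) rest) (==⇒≡ c==i)

anyFin : ∀ {n} → (Fin n → Bool) → Bool
anyFin {zero}  P = false
anyFin {suc n} P = P zero ∨ anyFin (λ i → P (suc i))

anyFin-intro : ∀ {n} (P : Fin n → Bool) i → P i ≡ true → anyFin P ≡ true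
anyFin-intro P zero    Pi rewrite Pi = refl
anyFin-intro P (suc i) Pi with P zero
... | true  = refl
... | false = anyFin-intro (λ i → P (suc i)) i Pi

anyFin-witness : ∀ {n} (P : Fin n → Bool) → anyFin P ≡ true → Σ (Fin n) λ i → P i ≡ true
anyFin-witness {suc n} P any with P zero in P0
... | true  = zero , P0
... | false with anyFin-witness (λ i → P (suc i)) any
...   | i , Pi = suc i , Pi

MapsTo : ∀ {a b} → (Fin a → Bool) → (Fin b → Bool) → (Fin a → Fin b) → Set
MapsTo A B f = ∀ i → A i ≡ true → B (f i) ≡ true

InjectiveOn : ∀ {a b} → (Fin a → Bool) → (Fin a → Fin b) → Set
InjectiveOn A f = ∀ i j → A i ≡ true → A j ≡ true → f i ≡ f j → i ≡ j

image : ∀ {a b} → (Fin a → Bool) → (Fin a → Fin b) → Fin b → Bool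
image A f u = anyFin (λ i → A i ∧ (f i == u))

image-intro : ∀ {a b} (A : Fin a → Bool) (f : Fin a → Fin b) i {u} → A i ≡ true → f i ≡ u → image A f u ≡ true
image-intro A f i Ai refl = anyFin-intro _ i (∧-true Ai (==-refl (f i)))

image-witness : ∀ {a b} (A : Fin a → Bool) (f : Fin a → Fin b) u → image A f u ≡ true →
                Σ (Fin a) λ i → A i ≡ true × f i ≡ u
image-witness A f u im with anyFin-witness _ im
... | i , Ai∧fi≡u = i , ∧-trueˡ (A i) Ai∧fi≡u , ==⇒≡ (∧-trueʳ (A i) Ai∧fi≡u)

count-image : ∀ {a b} (A : Fin a → Bool) (f : Fin a → Fin b) → InjectiveOn A f → count (image A f) ≡ count A
count-image {zero}  A f _   = count-false (image A f) (λ _ → refl)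
count-image {suc a} {b} A f inj =
  trans (count-∨ (λ u → A zero ∧ (f zero == u)) (image A′ f′) disjoint)
        (cong₂ _+_ head (count-image A′ f′ (λ i j Ai Aj e → suc-injective (inj (suc i) (suc j) Ai Aj e))))
  where
  A′ : Fin a → Bool
  A′ i = A (suc i)
  f′ : Fin a → Fin b
  f′ i = f (suc i)
  disjoint : ∀ u → (A zero ∧ (f zero == u)) ≡ true → image A′ f′ u ≡ true → ⊥
  disjoint u h im with image-witness A′ f′ u im
  ... | i , Ai , fi≡u with inj zero (suc i) (∧-trueˡ (A zero) h) Ai (trans (==⇒≡ (∧-trueʳ (A zero) h)) (sym fi≡u))
  ...   | ()
  head : count (λ u → A zero ∧ (f zero == u)) ≡ (if A zero then 1 else 0)
  head with A zero
  ... | true  = count-== (f zero)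
  ... | false = count-false {b} _ (λ _ → refl)

injection-exists : ∀ {a b} (A : Fin a → Bool) (B : Fin b → Bool) → (Fin a → Fin b) → count A ≤ count B →
                   Σ (Fin a → Fin b) λ f → MapsTo A B f × InjectiveOn A f
injection-exists {zero}  A B _ _ = (λ ()) , (λ ()) , (λ ())
injection-exists {suc a} A B default A≤B with A zero in A0
... | false with injection-exists (λ i → A (suc i)) B (λ i → default (suc i)) A≤B
...   | f , maps , inj = g , maps′ , inj′
  where
  g : Fin (suc a) → _
  g zero    = default zero
  g (suc i) = f i
  maps′ : MapsTo A B g
  maps′ zero    A0′ = ⊥-elim (true≢false A0′ A0)
  maps′ (suc i) Ai  = maps i Ai
  inj′ : InjectiveOn A g
  inj′ zero    _       A0′ _   _ = ⊥-elim (true≢false A0′ A0)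
  inj′ (suc i) zero    _   A0′ _ = ⊥-elim (true≢false A0′ A0)
  inj′ (suc i) (suc j) Ai  Aj  e = cong suc (inj i j Ai Aj e)
injection-exists {suc a} A B default A≤B | true
  with count>0⇒witness B (≤-trans (s≤s z≤n) A≤B)
... | c , Bc with injection-exists (λ i → A (suc i)) (λ u → B u ∧ not (c == u)) (λ i → default (suc i))
                    (≤-pred (≤-trans A≤B (≤-reflexive (count-remove B c Bc))))
...   | f , maps , inj = g , maps′ , inj′
  where
  g : Fin (suc a) → _
  g zero    = c
  g (suc i) = f i
  maps′ : MapsTo A B g
  maps′ zero    _  = Bc
  maps′ (suc i) Ai = ∧-trueˡ (B (f i)) (maps i Ai)
  c≢f : ∀ i → A (suc i) ≡ true → c ≢ f i
  c≢f i Ai = not==⇒≢ (∧-trueʳ (B (f i)) (maps i Ai))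
  inj′ : InjectiveOn A g
  inj′ zero    zero    _  _  _ = refl
  inj′ zero    (suc j) _  Aj e = ⊥-elim (c≢f j Aj e)
  inj′ (suc i) zero    Ai _  e = ⊥-elim (c≢f i Ai (sym e))
  inj′ (suc i) (suc j) Ai Aj e = cong suc (inj i j Ai Aj e)

injection-surjective : ∀ {a b} (A : Fin a → Bool) (B : Fin b → Bool) (f : Fin a → Fin b) →
                       MapsTo A B f → InjectiveOn A f → count A ≡ count B →
                       ∀ u → B u ≡ true → Σ (Fin a) λ i → A i ≡ true × f i ≡ u
injection-surjective A B f maps inj A≡B u Bu with image A f u in im
... | true  = image-witness A f u im
... | false = ⊥-elim (<-irrefl (trans (count-image A f inj) A≡B) (count-mono-< (image A f) B image⊆B u im Bu))
  where
  image⊆B : ∀ v → image A f v ≡ true → B v ≡ true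
  image⊆B v imv with image-witness A f v imv
  ... | i , Ai , refl = maps i Ai

-- Each orbit {v, g v} has exactly one element below its partner.
involution⇒count-even : ∀ {n} (Q : Fin n → Bool) (g : Fin n → Fin n) → MapsTo Q Q g →
                        (∀ v → Q v ≡ true → g v ≢ v) → (∀ v → Q v ≡ true → g (g v) ≡ v) →
                        Σ ℕ λ m → count Q ≡ m + m
involution⇒count-even {n} Q g maps no-fix invol = count L , (begin
  count Q                    ≡⟨ count-cong split ⟩
  count (λ v → L v ∨ U v)    ≡⟨ count-∨ L U disjoint ⟩
  count L + count U          ≡⟨ cong (count L +_) (trans (sym (count-cong g[L]≗U)) (count-image L g g-injective)) ⟩
  count L + count L          ∎)
  where
  open ≡-Reasoning
  L U : Fin n → Bool
  L v = Q v ∧ ⌊ v Fin.<? g v ⌋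
  U v = Q v ∧ ⌊ g v Fin.<? v ⌋

  split : ∀ v → Q v ≡ (L v ∨ U v)
  split v with Q v in Qv | Fin.<-cmp v (g v)
  ... | false | _                = refl
  ... | true  | tri< v<gv _ _    rewrite ⌊⌋-yes (v Fin.<? g v) v<gv = refl
  ... | true  | tri≈ _ v≡gv _    = ⊥-elim (no-fix v Qv (sym v≡gv))
  ... | true  | tri> v≮gv _ gv<v rewrite ⌊⌋-no (v Fin.<? g v) v≮gv | ⌊⌋-yes (g v Fin.<? v) gv<v = refl

  disjoint : ∀ v → L v ≡ true → U v ≡ true → ⊥
  disjoint v Lv Uv = Fin.<-asym (⌊⌋-true⇒ (∧-trueʳ (Q v) Lv)) (⌊⌋-true⇒ (∧-trueʳ (Q v) Uv))

  g-injective : InjectiveOn L g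
  g-injective i j Li Lj e = trans (sym (invol i (∧-trueˡ (Q i) Li))) (trans (cong g e) (invol j (∧-trueˡ (Q j) Lj)))

  L⇒U : ∀ v → L v ≡ true → U (g v) ≡ true
  L⇒U v Lv = ∧-true (maps v Qv)
               (⌊⌋-yes (g (g v) Fin.<? g v) (subst (Fin._< g v) (sym (invol v Qv)) (⌊⌋-true⇒ (∧-trueʳ (Q v) Lv))))
    where
    Qv : Q v ≡ true
    Qv = ∧-trueˡ (Q v) Lv

  U⇒L : ∀ v → U v ≡ true → L (g v) ≡ true
  U⇒L v Uv = ∧-true (maps v Qv)
               (⌊⌋-yes (g v Fin.<? g (g v)) (subst (g v Fin.<_) (sym (invol v Qv)) (⌊⌋-true⇒ (∧-trueʳ (Q v) Uv))))
    where
    Qv : Q v ≡ true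
    Qv = ∧-trueˡ (Q v) Uv

  g[L]≗U : ∀ u → image L g u ≡ U u
  g[L]≗U u = bool-ext image⇒U (λ Uu → image-intro L g (g u) (U⇒L u Uu) (invol u (∧-trueˡ (Q u) Uu)))
    where
    image⇒U : image L g u ≡ true → U u ≡ true
    image⇒U im with image-witness L g u im
    ... | v , Lv , refl = L⇒U v Lv

[m+[k+k]]%2≡m%2 : ∀ m k → (m + (k + k)) % 2 ≡ m % 2
[m+[k+k]]%2≡m%2 m k = trans (cong (λ z → (m + z) % 2) (solve 1 (λ k → k :+ k := k :* con 2) refl k)) ([m+kn]%n≡m%n m k 2)

m+m≢1+n+n : ∀ m n → m + m ≢ suc (n + n)
m+m≢1+n+n m n e = 0≢1+n (trans (sym ([m+[k+k]]%2≡m%2 0 m)) (trans (cong (_% 2) e) ([m+[k+k]]%2≡m%2 1 n)))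

parity : ∀ m → m % 2 ≡ 0 ⊎ m % 2 ≡ 1
parity zero          = inj₁ refl
parity (suc zero)    = inj₂ refl
parity (suc (suc m)) = parity m

even⇒suc-odd : ∀ m → m % 2 ≡ 0 → suc m % 2 ≡ 1
even⇒suc-odd zero          _    = refl
even⇒suc-odd (suc (suc m)) even = even⇒suc-odd m even

sumFin-odd : ∀ {d} (x : Fin d → ℕ) → (∀ i → x i % 2 ≡ 1) → sumFin x % 2 ≡ d % 2
sumFin-odd {zero}  x odd = refl
sumFin-odd {suc d} x odd = begin
  (x zero + sumFin x′) % 2              ≡⟨ %-distribˡ-+ (x zero) (sumFin x′) 2 ⟩
  (x zero % 2 + sumFin x′ % 2) % 2      ≡⟨ cong₂ (λ a b → (a + b) % 2) (odd zero) (sumFin-odd x′ (λ i → odd (suc i))) ⟩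
  (1 + d % 2) % 2                       ≡⟨ %-distribˡ-+ 1 d 2 ⟨
  suc d % 2                             ∎
  where
  open ≡-Reasoning
  x′ : Fin d → ℕ
  x′ i = x (suc i)

module _ (n : ℕ) .{{_ : NonZero n}} where

  %-≡⇒≡+k*n : ∀ {a b} → a % n ≡ b % n → a ≤ b → Σ ℕ λ k → b ≡ a + k * n
  %-≡⇒≡+k*n {a} {b} a≡b a≤b = b / n ∸ a / n , (begin
    b                                    ≡⟨ m≡m%n+[m/n]*n b n ⟩
    b % n + b / n * n                    ≡⟨ cong₂ (λ u v → u + v * n) (sym a≡b) (sym (m+[n∸m]≡n (/-monoˡ-≤ n a≤b))) ⟩
    a % n + (a / n + k) * n              ≡⟨ solve 4 (λ r q k n → r :+ (q :+ k) :* n := (r :+ q :* n) :+ k :* n)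
                                                     refl (a % n) (a / n) k n ⟩
    (a % n + a / n * n) + k * n          ≡⟨ cong (_+ k * n) (m≡m%n+[m/n]*n a n) ⟨
    a + k * n                            ∎)
    where
    open ≡-Reasoning
    k : ℕ
    k = b / n ∸ a / n

  private
    %-≡⇒≡-≤ : ∀ {a b} → a % n ≡ b % n → a ≤ b → b < a + n → a ≡ b
    %-≡⇒≡-≤ {a} a≡b a≤b b<a+n with %-≡⇒≡+k*n a≡b a≤b
    ... | zero  , b≡a+0    = sym (trans b≡a+0 (+-identityʳ a))
    ... | suc k , b≡a+n+kn = ⊥-elim (<⇒≱ b<a+n (≤-trans (+-monoʳ-≤ a (m≤m+n n (k * n))) (≤-reflexive (sym b≡a+n+kn))))

  %-≡⇒≡ : ∀ {a b} → a % n ≡ b % n → b < a + n → a < b + n → a ≡ b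
  %-≡⇒≡ {a} {b} a≡b b<a+n a<b+n with ≤-total a b
  ... | inj₁ a≤b = %-≡⇒≡-≤ a≡b a≤b b<a+n
  ... | inj₂ b≤a = sym (%-≡⇒≡-≤ (sym a≡b) b≤a a<b+n)

  %-cong-+ˡ : ∀ b {a a′} → a % n ≡ a′ % n → (b + a) % n ≡ (b + a′) % n
  %-cong-+ˡ b {a} {a′} a≡a′ = begin
    (b + a) % n              ≡⟨ %-distribˡ-+ b a n ⟩
    (b % n + a % n) % n      ≡⟨ cong (λ z → (b % n + z) % n) a≡a′ ⟩
    (b % n + a′ % n) % n     ≡⟨ %-distribˡ-+ b a′ n ⟨
    (b + a′) % n             ∎
    where open ≡-Reasoning

  %-cong-+ : ∀ {u u′ v v′} → u % n ≡ u′ % n → v % n ≡ v′ % n → (u + v) % n ≡ (u′ + v′) % n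
  %-cong-+ {u} {u′} {v} {v′} u≡u′ v≡v′ = begin
    (u + v) % n      ≡⟨ %-cong-+ˡ u v≡v′ ⟩
    (u + v′) % n     ≡⟨ cong (_% n) (+-comm u v′) ⟩
    (v′ + u) % n     ≡⟨ %-cong-+ˡ v′ u≡u′ ⟩
    (v′ + u′) % n    ≡⟨ cong (_% n) (+-comm v′ u′) ⟩
    (u′ + v′) % n    ∎
    where open ≡-Reasoning

  %-cong-*ʳ : ∀ {a a′} c → a % n ≡ a′ % n → (a * c) % n ≡ (a′ * c) % n
  %-cong-*ʳ {a} {a′} c a≡a′ = begin
    (a * c) % n              ≡⟨ %-distribˡ-* a c n ⟩
    (a % n * (c % n)) % n    ≡⟨ cong (λ z → (z * (c % n)) % n) a≡a′ ⟩
    (a′ % n * (c % n)) % n   ≡⟨ %-distribˡ-* a′ c n ⟨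
    (a′ * c) % n             ∎
    where open ≡-Reasoning

  +-cancelˡ-% : ∀ c {b b′} → (c + b) % n ≡ (c + b′) % n → b′ < b + n → b < b′ + n → b ≡ b′
  +-cancelˡ-% c {b} {b′} c+b≡c+b′ b′<b+n b<b′+n =
    +-cancelˡ-≡ c b b′ (%-≡⇒≡ c+b≡c+b′ (shift b′<b+n) (shift b<b′+n))
    where
    shift : ∀ {u v} → u < v + n → c + u < c + v + n
    shift {u} {v} u<v+n = ≤-trans (≤-reflexive (sym (+-suc c u))) (≤-trans (+-monoʳ-≤ c u<v+n) (≤-reflexive (sym (+-assoc c v n))))

  +-solve-% : ∀ a t → Σ ℕ λ b → b < n × (a + b) % n ≡ t % n
  +-solve-% a t = X % n , m%n<n X n , (begin
    (a + X % n) % n                          ≡⟨ %-cong-+ˡ a (m%n%n≡m%n X n) ⟩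
    (a + X) % n                              ≡⟨ cong (_% n) (+-comm a X) ⟩
    (X + a) % n                              ≡⟨ cong (λ z → (X + z) % n) (m≡m%n+[m/n]*n a n) ⟩
    (X + (a % n + a / n * n)) % n            ≡⟨ cong (_% n) (solve 4 (λ t u v w → (t :+ u) :+ (w :+ v) := (t :+ (w :+ u)) :+ v)
                                                                  refl t (n ∸ a % n) (a / n * n) (a % n)) ⟩
    (t + (a % n + (n ∸ a % n)) + a / n * n) % n  ≡⟨ [m+kn]%n≡m%n _ (a / n) n ⟩
    (t + (a % n + (n ∸ a % n))) % n          ≡⟨ cong (λ z → (t + z) % n) (m+[n∸m]≡n (m%n≤n a n)) ⟩
    (t + n) % n                              ≡⟨ [m+n]%n≡m%n t n ⟩
    t % n                                    ∎)
    where
    open ≡-Reasoning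
    X : ℕ
    X = t + (n ∸ a % n)

  -- For odd n, half is the inverse of 2 modulo n.
  module _ (n-odd : n % 2 ≡ 1) where

    half : ℕ
    half = suc n / 2

    half+half : half + half ≡ suc n
    half+half = begin
      half + half            ≡⟨ solve 1 (λ h → h :+ h := h :* con 2) refl half ⟩
      half * 2               ≡⟨ cong (_+ half * 2) (trans (%-distribˡ-+ 1 n 2) (cong (λ z → (1 + z) % 2) n-odd)) ⟨
      suc n % 2 + half * 2   ≡⟨ m≡m%n+[m/n]*n (suc n) 2 ⟨
      suc n                  ∎
      where open ≡-Reasoning

    double*half-% : ∀ b → ((b + b) * half) % n ≡ b % n
    double*half-% b = begin
      ((b + b) * half) % n   ≡⟨ cong (_% n) (solve 2 (λ b h → (b :+ b) :* h := b :* (h :+ h)) refl b half) ⟩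
      (b * (half + half)) % n ≡⟨ cong (λ z → (b * z) % n) half+half ⟩
      (b * suc n) % n        ≡⟨ cong (_% n) (*-suc b n) ⟩
      (b + b * n) % n        ≡⟨ [m+kn]%n≡m%n b b n ⟩
      b % n                  ∎
      where open ≡-Reasoning

    double-solve-% : ∀ t → Σ ℕ λ c → (c + c) % n ≡ t % n
    double-solve-% t = t * half , (begin
      (t * half + t * half) % n ≡⟨ cong (_% n) (solve 2 (λ t h → t :* h :+ t :* h := (t :+ t) :* h) refl t half) ⟩
      ((t + t) * half) % n      ≡⟨ double*half-% t ⟩
      t % n                     ∎)
      where open ≡-Reasoning

    double-cancel-% : ∀ {b b′} → (b + b) % n ≡ (b′ + b′) % n → b′ < b + n → b < b′ + n → b ≡ b′
    double-cancel-% {b} {b′} 2b≡2b′ = %-≡⇒≡ (begin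
      b % n                    ≡⟨ double*half-% b ⟨
      ((b + b) * half) % n     ≡⟨ %-cong-*ʳ half 2b≡2b′ ⟩
      ((b′ + b′) * half) % n   ≡⟨ double*half-% b′ ⟩
      b′ % n                   ∎)
      where open ≡-Reasoning

-- Necessity of the parity conditions

module _ {d r} {G : SimpleGraph r} {p : Fin r → Fin d} (regular : Regular (d ∸ 1) G) (C : SunColouring G p) where
  open SunColouring C

  col-injective : ∀ v → InjectiveOn (adj G v) (col v)
  col-injective v u w vu vw same with u ≟ w
  ... | yes u≡w = u≡w
  ... | no  u≢w = ⊥-elim (proper v u w vu vw u≢w same)

  -- The d - 1 edges at v carry distinct colours, all different from p v, so they carry all of them.
  colour-present : ∀ v j → p v ≢ j → Σ (Fin r) λ u → adj G v u ≡ true × col v u ≡ j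
  colour-present v j pv≢j = injection-surjective (adj G v) (λ k → not (p v == k)) (col v)
                               (λ u vu → ≢⇒not== (λ pv≡ → pendant v u vu (sym pv≡))) (col-injective v)
                               (trans (regular v) (sym (count-not-== (p v)))) j (≢⇒not== pv≢j)

  -- The neighbour of v along its edge of colour j, or v itself when p v ≡ j.
  j-neighbour : Fin d → Fin r → Fin r
  j-neighbour j v with p v ≟ j
  ... | yes _    = v
  ... | no pv≢j = proj₁ (colour-present v j pv≢j)

  j-neighbour-spec : ∀ j v → p v ≢ j → adj G v (j-neighbour j v) ≡ true × col v (j-neighbour j v) ≡ j
  j-neighbour-spec j v pv≢j with p v ≟ j
  ... | yes pv≡j = ⊥-elim (pv≢j pv≡j)
  ... | no  pv≢j = proj₂ (colour-present v j pv≢j)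

  private
    g : Fin d → Fin r → Fin r
    g = j-neighbour

  j-neighbour-uncoloured : ∀ j v → p v ≢ j → p (g j v) ≢ j
  j-neighbour-uncoloured j v pv≢j pgv≡j with j-neighbour-spec j v pv≢j
  ... | v~gv , colour = pendant (g j v) v (trans (SimpleGraph.sym G (g j v) v) v~gv)
                          (trans (sym (col-sym v (g j v) v~gv)) (trans colour (sym pgv≡j)))

  j-neighbour-≢ : ∀ j v → p v ≢ j → g j v ≢ v
  j-neighbour-≢ j v pv≢j gv≡v with j-neighbour-spec j v pv≢j
  ... | v~gv , _ = true≢false (subst (λ u → adj G v u ≡ true) gv≡v v~gv) (irrefl G v)

  j-neighbour-involutive : ∀ j v → p v ≢ j → g j (g j v) ≡ v
  j-neighbour-involutive j v pv≢j with j-neighbour-spec j v pv≢j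
                                     | j-neighbour-spec j (g j v) (j-neighbour-uncoloured j v pv≢j)
  ... | v~gv , colour | gv~ggv , colour′ with g j (g j v) ≟ v
  ...   | yes ggv≡v = ggv≡v
  ...   | no  ggv≢v = ⊥-elim (proper (g j v) (g j (g j v)) v gv~ggv (trans (SimpleGraph.sym G (g j v) v) v~gv) ggv≢v
                                 (trans colour′ (sym (trans (sym (col-sym v (g j v) v~gv)) colour))))

  colourClassSize-parity : ∀ j → colourClassSize p j % 2 ≡ r % 2
  colourClassSize-parity j with involution⇒count-even (λ v → not (p v == j)) (g j)
                                  (λ v Qv → ≢⇒not== (j-neighbour-uncoloured j v (not==⇒≢ Qv)))
                                  (λ v Qv → j-neighbour-≢ j v (not==⇒≢ Qv))
                                  (λ v Qv → j-neighbour-involutive j v (not==⇒≢ Qv))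
  ... | m , even = begin
    colourClassSize p j % 2                                      ≡⟨ [m+[k+k]]%2≡m%2 (colourClassSize p j) m ⟨
    (colourClassSize p j + (m + m)) % 2                          ≡⟨ cong (λ z → (colourClassSize p j + z) % 2) even ⟨
    (count (λ v → p v == j) + count (λ v → not (p v == j))) % 2  ≡⟨ cong (_% 2) (count-+-count-not (λ v → p v == j)) ⟩
    r % 2                                                        ∎
    where open ≡-Reasoning

parity-conditions-necessary : ∀ {d′ r} (x : Fin (suc d′) → ℕ) → sumFin x ≡ r → (p : Fin r → Fin (suc d′)) →
                              (∀ i → colourClassSize p i ≡ x i) → Σ (SimpleGraph r) (λ G → Regular d′ G × SunColouring G p) →
                              (∀ i → x i % 2 ≡ r % 2) × (r % 2 ≡ 1 → suc d′ % 2 ≡ 1)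
parity-conditions-necessary {d′} {r} x sum≡r p sizes (G , regular , C) = parities , d-odd
  where
  parities : ∀ i → x i % 2 ≡ r % 2
  parities i = trans (cong (_% 2) (sym (sizes i))) (colourClassSize-parity regular C i)
  d-odd : r % 2 ≡ 1 → suc d′ % 2 ≡ 1
  d-odd r-odd = trans (sym (sumFin-odd x (λ i → trans (parities i) r-odd))) (trans (cong (_% 2) sum≡r) r-odd)

-- Colour matchings and the graphs they span

private
  pick : ∀ {n} (P : Fin n → Bool) → Fin n → (b : Bool) → anyFin P ≡ b → Fin n
  pick P _       true  any = proj₁ (anyFin-witness P any)
  pick P default false _   = default

find : ∀ {n} → (Fin n → Bool) → Fin n → Fin n
find P default = pick P default (anyFin P) refl

find-spec : ∀ {n} (P : Fin n → Bool) default → anyFin P ≡ true → P (find P default) ≡ true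
find-spec P default any = pick-spec (anyFin P) refl
  where
  pick-spec : ∀ b (e : anyFin P ≡ b) → P (pick P default b e) ≡ true
  pick-spec true  e = proj₂ (anyFin-witness P e)
  pick-spec false e = ⊥-elim (true≢false any e)

-- matched j is a perfect matching of the vertices a with p a ≢ j (pairs at vertices of
-- colour j are ignored), and different colours never match the same pair.
record ColourMatchings {d r : ℕ} (p : Fin r → Fin d) : Set where
  field
    matched            : Fin d → Fin r → Fin r → Bool
    matched-sym        : ∀ j a b → matched j a b ≡ true → matched j b a ≡ true
    partner            : ∀ j a → p a ≢ j → Σ (Fin r) λ b → matched j a b ≡ true
    partner-unique     : ∀ j a b b′ → p a ≢ j → matched j a b ≡ true → matched j a b′ ≡ true → b ≡ b′
    partner-≢          : ∀ j a b → p a ≢ j → matched j a b ≡ true → b ≢ a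
    partner-uncoloured : ∀ j a b → p a ≢ j → matched j a b ≡ true → p b ≢ j
    matchings-disjoint : ∀ j k a b → p a ≢ j → p a ≢ k → matched j a b ≡ true → matched k a b ≡ true → j ≡ k

module UnionGraph {d r : ℕ} {p : Fin r → Fin d} (M : ColourMatchings p) where
  open ColourMatchings M

  edge-of-colour : Fin r → Fin r → Fin d → Bool
  edge-of-colour v u j = not (p v == j) ∧ matched j v u

  adjacent : Fin r → Fin r → Bool
  adjacent v u = anyFin (edge-of-colour v u)

  edge-of-colour⇒ : ∀ {v u j} → edge-of-colour v u j ≡ true → p v ≢ j × matched j v u ≡ true
  edge-of-colour⇒ {v} {u} {j} e = not==⇒≢ (∧-trueˡ (not (p v == j)) e) , ∧-trueʳ (not (p v == j)) e

  edge-of-colour⇐ : ∀ {v u j} → p v ≢ j → matched j v u ≡ true → edge-of-colour v u j ≡ true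
  edge-of-colour⇐ pv≢j vu = ∧-true (≢⇒not== pv≢j) vu

  adjacent-sym : ∀ u v → adjacent u v ≡ adjacent v u
  adjacent-sym u v = bool-ext (flip u v) (flip v u)
    where
    flip : ∀ u v → adjacent u v ≡ true → adjacent v u ≡ true
    flip u v uv with anyFin-witness _ uv
    ... | j , e with edge-of-colour⇒ e
    ...   | pu≢j , uv′ = anyFin-intro _ j (edge-of-colour⇐ (partner-uncoloured j u v pu≢j uv′) (matched-sym j u v uv′))

  adjacent-irrefl : ∀ v → adjacent v v ≡ false
  adjacent-irrefl v with adjacent v v in vv
  ... | false = refl
  ... | true with anyFin-witness _ vv
  ...   | j , e with edge-of-colour⇒ e
  ...     | pv≢j , vv′ = ⊥-elim (partner-≢ j v v pv≢j vv′ refl)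

  G : SimpleGraph r
  G = record { adj = adjacent ; sym = adjacent-sym ; irrefl = adjacent-irrefl }

  partnerOf : Fin d → Fin r → Fin r
  partnerOf j v with p v ≟ j
  ... | yes _    = v
  ... | no pv≢j = proj₁ (partner j v pv≢j)

  partnerOf-matched : ∀ j v → p v ≢ j → matched j v (partnerOf j v) ≡ true
  partnerOf-matched j v pv≢j with p v ≟ j
  ... | yes pv≡j = ⊥-elim (pv≢j pv≡j)
  ... | no  pv≢j = proj₂ (partner j v pv≢j)

  regular : Regular (d ∸ 1) G
  regular v = trans (count-cong neighbours≗partners) (trans (count-image other partners partners-injective) (count-not-== (p v)))
    where
    other : Fin d → Bool
    other j = not (p v == j)
    partners : Fin d → Fin r
    partners j = partnerOf j v
    partners-injective : InjectiveOn other partners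
    partners-injective i j oi oj same = matchings-disjoint i j v (partners i) (not==⇒≢ oi) (not==⇒≢ oj)
      (partnerOf-matched i v (not==⇒≢ oi)) (subst (λ u → matched j v u ≡ true) (sym same) (partnerOf-matched j v (not==⇒≢ oj)))
    neighbours≗partners : ∀ u → adjacent v u ≡ image other partners u
    neighbours≗partners u = bool-ext neighbour⇒partner partner⇒neighbour
      where
      neighbour⇒partner : adjacent v u ≡ true → image other partners u ≡ true
      neighbour⇒partner vu with anyFin-witness _ vu
      ... | j , e with edge-of-colour⇒ e
      ...   | pv≢j , vu′ = image-intro other partners j (≢⇒not== pv≢j)
                             (partner-unique j v (partners j) u pv≢j (partnerOf-matched j v pv≢j) vu′)
      partner⇒neighbour : image other partners u ≡ true → adjacent v u ≡ true
      partner⇒neighbour im with image-witness other partners u im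
      ... | j , oj , refl = anyFin-intro _ j (edge-of-colour⇐ (not==⇒≢ oj) (partnerOf-matched j v (not==⇒≢ oj)))

  colour : Fin r → Fin r → Fin d
  colour v u = find (edge-of-colour v u) (p v)

  colour-spec : ∀ v u → adjacent v u ≡ true → p v ≢ colour v u × matched (colour v u) v u ≡ true
  colour-spec v u vu = edge-of-colour⇒ (find-spec (edge-of-colour v u) (p v) vu)

  sunColouring : SunColouring G p
  sunColouring = record
    { col     = colour
    ; col-sym = colour-sym
    ; proper  = colour-proper
    ; pendant = λ v u vu same → proj₁ (colour-spec v u vu) (sym same)
    }
    where
    colour-proper : ∀ v u w → adjacent v u ≡ true → adjacent v w ≡ true → u ≢ w → colour v u ≢ colour v w
    colour-proper v u w vu vw u≢w same with colour-spec v u vu | colour-spec v w vw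
    ... | pv≢j , vu′ | _ , vw′ = u≢w (partner-unique (colour v u) v u w pv≢j vu′ (subst (λ j → matched j v w ≡ true) (sym same) vw′))

    colour-sym : ∀ u v → adjacent u v ≡ true → colour u v ≡ colour v u
    colour-sym u v uv with colour-spec u v uv | colour-spec v u (trans (adjacent-sym v u) uv)
    ... | pu≢j , uv′ | pv≢k , vu′ = matchings-disjoint (colour u v) (colour v u) v u
                                      (partner-uncoloured (colour u v) u v pu≢j uv′) pv≢k (matched-sym (colour u v) u v uv′) vu′

sunColouring-from-matchings : ∀ {d r} {p : Fin r → Fin d} → ColourMatchings p →
                              Σ (SimpleGraph r) λ G → Regular (d ∸ 1) G × SunColouring G p
sunColouring-from-matchings M = G , regular , sunColouring
  where open UnionGraph M

module _ {d r : ℕ} {p q : Fin r → Fin d} (same-sizes : ∀ k → colourClassSize p k ≡ colourClassSize q k) where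

  private
    class-injection : ∀ k → Σ (Fin r → Fin r) λ f →
                      MapsTo (λ v → p v == k) (λ y → q y == k) f × InjectiveOn (λ v → p v == k) f
    class-injection k = injection-exists (λ v → p v == k) (λ y → q y == k) id (≤-reflexive (same-sizes k))

  relabelling : Fin r → Fin r
  relabelling v = proj₁ (class-injection (p v)) v

  relabelling-colour : ∀ v → q (relabelling v) ≡ p v
  relabelling-colour v = ==⇒≡ (proj₁ (proj₂ (class-injection (p v))) v (==-refl (p v)))

  relabelling-injective : ∀ u v → relabelling u ≡ relabelling v → u ≡ v
  relabelling-injective u v same =
    proj₂ (proj₂ (class-injection (p v))) u v (subst (λ k → (p u == k) ≡ true) pu≡pv (==-refl (p u))) (==-refl (p v))
          (subst (λ k → proj₁ (class-injection k) u ≡ relabelling v) pu≡pv same)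
    where
    pu≡pv : p u ≡ p v
    pu≡pv = trans (sym (relabelling-colour u)) (trans (cong q same) (relabelling-colour v))

  relabelling-surjective : ∀ y → Σ (Fin r) λ v → relabelling v ≡ y
  relabelling-surjective y with injection-surjective (λ _ → true) (λ _ → true) relabelling (λ _ _ → refl)
                                  (λ u v _ _ → relabelling-injective u v) refl y refl
  ... | v , _ , σv≡y = v , σv≡y

  ColourMatchings-relabel : ColourMatchings q → ColourMatchings p
  ColourMatchings-relabel M = record
    { matched            = λ j a b → matched j (σ a) (σ b)
    ; matched-sym        = λ j a b → matched-sym j (σ a) (σ b)
    ; partner            = λ j a pa≢j → let (b , ab) = partner j (σ a) (uncoloured a pa≢j)
                                            (w , σw≡b) = relabelling-surjective b
                                        in w , subst (λ z → matched j (σ a) z ≡ true) (sym σw≡b) ab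
    ; partner-unique     = λ j a b b′ pa≢j ab ab′ →
                             relabelling-injective b b′ (partner-unique j (σ a) (σ b) (σ b′) (uncoloured a pa≢j) ab ab′)
    ; partner-≢          = λ j a b pa≢j ab b≡a → partner-≢ j (σ a) (σ b) (uncoloured a pa≢j) ab (cong σ b≡a)
    ; partner-uncoloured = λ j a b pa≢j ab pb≡j →
                             partner-uncoloured j (σ a) (σ b) (uncoloured a pa≢j) ab (trans (relabelling-colour b) pb≡j)
    ; matchings-disjoint = λ j k a b pa≢j pa≢k → matchings-disjoint j k (σ a) (σ b) (uncoloured a pa≢j) (uncoloured a pa≢k)
    }
    where
    open ColourMatchings M
    σ : Fin r → Fin r
    σ = relabelling
    uncoloured : ∀ {j} a → p a ≢ j → q (σ a) ≢ j
    uncoloured a pa≢j qσa≡j = pa≢j (trans (sym (relabelling-colour a)) qσa≡j)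

-- Colour classes as consecutive blocks

inInterval : ℕ → ℕ → ℕ → Bool
inInterval lo hi y = (lo ≤ᵇ y) ∧ (y <ᵇ hi)

inInterval⇒ : ∀ lo hi y → inInterval lo hi y ≡ true → lo ≤ y × y < hi
inInterval⇒ lo hi y e = ≤ᵇ⇒≤ lo y (Equivalence.from T-≡ (∧-trueˡ (lo ≤ᵇ y) e))
                      , <ᵇ⇒< y hi (Equivalence.from T-≡ (∧-trueʳ (lo ≤ᵇ y) e))

inInterval⇐ : ∀ {lo hi y} → lo ≤ y → y < hi → inInterval lo hi y ≡ true
inInterval⇐ lo≤y y<hi = ∧-true (Equivalence.to T-≡ (≤⇒≤ᵇ lo≤y)) (Equivalence.to T-≡ (<⇒<ᵇ y<hi))

count-inInterval : ∀ n lo hi → lo ≤ hi → hi ≤ n → count {n} (λ y → inInterval lo hi (toℕ y)) ≡ hi ∸ lo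
count-inInterval zero    zero    zero    _        _         = refl
count-inInterval (suc n) zero    zero    _        _         = count-false {n} _ (λ _ → refl)
count-inInterval (suc n) zero    (suc h) _        (s≤s h≤n) = cong suc (count-inInterval n zero h z≤n h≤n)
count-inInterval (suc n) (suc l) (suc h) (s≤s l≤h) (s≤s h≤n) =
  trans (count-cong {n} (λ y → shift l (toℕ y))) (count-inInterval n l h l≤h h≤n)
  where
  shift : ∀ l y → inInterval (suc l) (suc h) (suc y) ≡ inInterval l h y
  shift zero    y = refl
  shift (suc l) y = refl

reflect : ∀ {lo l y} → lo ≤ y → y ≤ lo + l → Σ ℕ λ y* → lo ≤ y* × y* ≤ lo + l × y + y* ≡ lo + lo + l
reflect {lo} {l} {y} lo≤y y≤lo+l = lo + (l ∸ e) , m≤m+n lo _ , +-monoʳ-≤ lo (m∸n≤m l e) , (begin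
  y + (lo + (l ∸ e))          ≡⟨ cong (_+ (lo + (l ∸ e))) (m+[n∸m]≡n lo≤y) ⟨
  lo + e + (lo + (l ∸ e))     ≡⟨ solve 3 (λ lo e l′ → lo :+ e :+ (lo :+ l′) := lo :+ lo :+ (e :+ l′)) refl lo e (l ∸ e) ⟩
  lo + lo + (e + (l ∸ e))     ≡⟨ cong (lo + lo +_) (m+[n∸m]≡n e≤l) ⟩
  lo + lo + l                 ∎)
  where
  open ≡-Reasoning
  e : ℕ
  e = y ∸ lo
  e≤l : e ≤ l
  e≤l = ≤-trans (∸-monoˡ-≤ lo y≤lo+l) (≤-reflexive (m+n∸m≡n lo l))

start : ∀ {d} → (Fin d → ℕ) → Fin d → ℕ
start x zero    = 0
start x (suc k) = x zero + start (λ i → x (suc i)) k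

start+size≤sumFin : ∀ {d} (x : Fin d → ℕ) k → start x k + x k ≤ sumFin x
start+size≤sumFin x zero    = m≤m+n (x zero) _
start+size≤sumFin x (suc k) =
  ≤-trans (≤-reflexive (+-assoc (x zero) _ _)) (+-monoʳ-≤ (x zero) (start+size≤sumFin (λ i → x (suc i)) k))

blockOf : ∀ {d} → (Fin (suc d) → ℕ) → ℕ → Fin (suc d)
blockOf {zero}  x y = zero
blockOf {suc d} x y with y <? x zero
... | yes _ = zero
... | no  _ = suc (blockOf (λ i → x (suc i)) (y ∸ x zero))

shift-interval : ∀ a {s e y} → a ≤ y → s ≤ y ∸ a × y ∸ a < s + e → a + s ≤ y × y < a + s + e
shift-interval a {s} {e} {y} a≤y (lo , hi) =
  subst (a + s ≤_) y≡ (+-monoʳ-≤ a lo) , subst (_< a + s + e) y≡ (subst (a + (y ∸ a) <_) (sym (+-assoc a s e)) (+-monoʳ-< a hi))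
  where
  y≡ : a + (y ∸ a) ≡ y
  y≡ = m+[n∸m]≡n a≤y

unshift-interval : ∀ a {s e y} → a ≤ y → a + s ≤ y → y < a + s + e → s ≤ y ∸ a × y ∸ a < s + e
unshift-interval a {s} {e} {y} a≤y lo hi =
  +-cancelˡ-≤ a s (y ∸ a) (subst (a + s ≤_) (sym y≡) lo) ,
  +-cancelˡ-< a (y ∸ a) (s + e) (subst₂ _<_ (sym y≡) (+-assoc a s e) hi)
  where
  y≡ : a + (y ∸ a) ≡ y
  y≡ = m+[n∸m]≡n a≤y

blockOf-inside : ∀ {d} (x : Fin (suc d) → ℕ) y → y < sumFin x →
                 start x (blockOf x y) ≤ y × y < start x (blockOf x y) + x (blockOf x y)
blockOf-inside {zero}  x y y<sum = z≤n , ≤-trans y<sum (≤-reflexive (+-identityʳ (x zero)))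
blockOf-inside {suc d} x y y<sum with y <? x zero
... | yes y<x₀ = z≤n , y<x₀
... | no  y≮x₀ = shift-interval (x zero) (≮⇒≥ y≮x₀) (blockOf-inside (λ i → x (suc i)) (y ∸ x zero)
                   (subst (y ∸ x zero <_) (m+n∸m≡n (x zero) _) (∸-monoˡ-< y<sum (≮⇒≥ y≮x₀))))

inside⇒blockOf : ∀ {d} (x : Fin (suc d) → ℕ) {y} k → start x k ≤ y → y < start x k + x k → blockOf x y ≡ k
inside⇒blockOf {zero}  x zero _ _ = refl
inside⇒blockOf {suc d} x {y} k lo hi with y <? x zero
inside⇒blockOf {suc d} x zero    lo hi | yes _    = refl
inside⇒blockOf {suc d} x (suc k) lo hi | yes y<x₀ = ⊥-elim (<⇒≱ y<x₀ (≤-trans (m≤m+n (x zero) _) lo))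
inside⇒blockOf {suc d} x zero    lo hi | no  y≮x₀ = ⊥-elim (y≮x₀ hi)
inside⇒blockOf {suc d} x (suc k) lo hi | no  y≮x₀ =
  let lo′ , hi′ = unshift-interval (x zero) (≮⇒≥ y≮x₀) lo hi in
  cong suc (inside⇒blockOf (λ i → x (suc i)) k lo′ hi′)

module Layout {d r : ℕ} (x : Fin (suc d) → ℕ) (sum≡r : sumFin x ≡ r) where

  block : Fin r → Fin (suc d)
  block y = blockOf x (toℕ y)

  block-inside : ∀ y → start x (block y) ≤ toℕ y × toℕ y < start x (block y) + x (block y)
  block-inside y = blockOf-inside x (toℕ y) (subst (toℕ y <_) (sym sum≡r) (toℕ<n y))

  block-size : ∀ k → colourClassSize block k ≡ x k
  block-size k = trans (count-cong in-k≗interval)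
    (trans (count-inInterval r (start x k) (start x k + x k) (m≤m+n _ _) (subst (_ ≤_) sum≡r (start+size≤sumFin x k)))
           (m+n∸m≡n (start x k) (x k)))
    where
    in-k≗interval : ∀ y → (block y == k) ≡ inInterval (start x k) (start x k + x k) (toℕ y)
    in-k≗interval y = bool-ext
      (λ e → let (lo , hi) = block-inside y in
              inInterval⇐ (subst (λ z → start x z ≤ toℕ y) (==⇒≡ e) lo) (subst (λ z → toℕ y < start x z + x z) (==⇒≡ e) hi))
      (λ e → let (lo , hi) = inInterval⇒ (start x k) _ (toℕ y) e in
              subst (λ z → (z == k) ≡ true) (sym (inside⇒blockOf x k lo hi)) (==-refl k))

  reflection-sum : Fin (suc d) → ℕ
  reflection-sum k = start x k + start x k + (x k ∸ 1)

  mirror : ∀ y → Σ (Fin r) λ y* → block y* ≡ block y × toℕ y + toℕ y* ≡ reflection-sum (block y)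
  mirror y with block y | block-inside y
  ... | k | lo , hi with x k in xk
  ...   | zero  = ⊥-elim (<⇒≱ (subst (toℕ y <_) (+-identityʳ _) hi) lo)
  ...   | suc l with reflect {l = l} lo (≤-pred (≤-trans hi (≤-reflexive (+-suc _ l))))
  ...     | y* , lo* , hi* , sum = fromℕ< y*<r
                                 , trans (cong (blockOf x) (toℕ-fromℕ< y*<r)) (inside⇒blockOf x k lo* hi*′)
                                 , trans (cong (toℕ y +_) (toℕ-fromℕ< y*<r)) sum
    where
    hi*′ : y* < start x k + x k
    hi*′ = ≤-trans (s≤s hi*) (≤-reflexive (trans (sym (+-suc _ l)) (cong (start x k +_) (sym xk))))
    y*<r : y* < r
    y*<r = ≤-trans hi*′ (subst (_ ≤_) sum≡r (start+size≤sumFin x k))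

  centre : Fin (suc d) → ℕ
  centre k = start x k + x k / 2

  module _ {k} (k-nonempty : x k ≢ 0) where

    centre-inside : centre k < start x k + x k
    centre-inside = +-monoʳ-< (start x k) (m/n<m (x k) 2 {{≢-nonZero k-nonempty}} (s≤s (s≤s z≤n)))

    centre<r : centre k < r
    centre<r = ≤-trans centre-inside (subst (start x k + x k ≤_) sum≡r (start+size≤sumFin x k))

    blockOf-centre : blockOf x (centre k) ≡ k
    blockOf-centre = inside⇒blockOf x k (m≤m+n _ _) centre-inside

-- Odd r

module OddConstruction {d′ r′ : ℕ} (x : Fin (suc d′) → ℕ) (sum≡r : sumFin x ≡ suc r′)
                       (x-odd : ∀ k → x k % 2 ≡ 1) (r-odd : suc r′ % 2 ≡ 1) where

  r : ℕ
  r = suc r′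

  open Layout x sum≡r

  nonempty : ∀ k → x k ≢ 0
  nonempty k x≡0 = 0≢1+n (subst (λ z → z % 2 ≡ 1) x≡0 (x-odd k))

  x≡1+2h : ∀ k → x k ≡ suc (x k / 2 + x k / 2)
  x≡1+2h k = begin
    x k                    ≡⟨ m≡m%n+[m/n]*n (x k) 2 ⟩
    x k % 2 + x k / 2 * 2  ≡⟨ cong (_+ x k / 2 * 2) (x-odd k) ⟩
    suc (x k / 2 * 2)      ≡⟨ cong suc (solve 1 (λ h → h :* con 2 := h :+ h) refl (x k / 2)) ⟩
    suc (x k / 2 + x k / 2) ∎
    where open ≡-Reasoning

  reflection-sum≡2centre : ∀ k → reflection-sum k ≡ centre k + centre k
  reflection-sum≡2centre k = trans (cong (λ z → start x k + start x k + (z ∸ 1)) (x≡1+2h k))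
                                   (solve 2 (λ s h → s :+ s :+ (h :+ h) := (s :+ h) :+ (s :+ h)) refl (start x k) (x k / 2))

  matched : Fin (suc d′) → Fin r → Fin r → Bool
  matched j a b = ⌊ (toℕ a + toℕ b) % r ≟ℕ (centre j + centre j) % r ⌋

  matched⇒ : ∀ j a b → matched j a b ≡ true → (toℕ a + toℕ b) % r ≡ (centre j + centre j) % r
  matched⇒ _ _ _ = ⌊⌋-true⇒

  matched⇐ : ∀ j a b → (toℕ a + toℕ b) % r ≡ (centre j + centre j) % r → matched j a b ≡ true
  matched⇐ _ _ _ = ⌊⌋-yes (_ ≟ℕ _)

  <r⇒<+r : ∀ {u} m → u < r → u < m + r
  <r⇒<+r m u<r = ≤-trans u<r (m≤n+m r m)

  matched-sym : ∀ j a b → matched j a b ≡ true → matched j b a ≡ true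
  matched-sym j a b ab = matched⇐ j b a (trans (cong (_% r) (+-comm (toℕ b) (toℕ a))) (matched⇒ j a b ab))

  partner-unique : ∀ j a b b′ → matched j a b ≡ true → matched j a b′ ≡ true → b ≡ b′
  partner-unique j a b b′ ab ab′ = toℕ-injective (+-cancelˡ-% r (toℕ a) (trans (matched⇒ j a b ab) (sym (matched⇒ j a b′ ab′)))
                                                   (<r⇒<+r (toℕ b) (toℕ<n b′)) (<r⇒<+r (toℕ b′) (toℕ<n b)))

  colourMatchings : ColourMatchings block
  colourMatchings = record
    { matched            = matched
    ; matched-sym        = matched-sym
    ; partner            = partner
    ; partner-unique     = λ j a b b′ _ → partner-unique j a b b′
    ; partner-≢          = partner-≢
    ; partner-uncoloured = partner-uncoloured
    ; matchings-disjoint = matchings-disjoint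
    }
    where
    partner : ∀ j a → block a ≢ j → Σ (Fin r) λ b → matched j a b ≡ true
    partner j a _ with +-solve-% r (toℕ a) (centre j + centre j)
    ... | b , b<r , sum = fromℕ< b<r , matched⇐ j a _ (trans (cong (λ z → (toℕ a + z) % r) (toℕ-fromℕ< b<r)) sum)

    partner-≢ : ∀ j a b → block a ≢ j → matched j a b ≡ true → b ≢ a
    partner-≢ j a b a∉j ab refl = a∉j (trans (cong (blockOf x) a≡centre) (blockOf-centre (nonempty j)))
      where
      a≡centre : toℕ a ≡ centre j
      a≡centre = double-cancel-% r r-odd (matched⇒ j a a ab) (<r⇒<+r (toℕ a) (centre<r (nonempty j))) (<r⇒<+r (centre j) (toℕ<n a))

    -- Block j is closed under the colour-j matching: it is matched to itself by reflection.
    partner-uncoloured : ∀ j a b → block a ≢ j → matched j a b ≡ true → block b ≢ j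
    partner-uncoloured j a b a∉j ab refl with mirror b
    ... | b* , b*∈j , sum = a∉j (trans (cong block a≡b*) b*∈j)
      where
      a≡b* : a ≡ b*
      a≡b* = partner-unique (block b) b a b* (matched-sym (block b) a b ab)
                            (matched⇐ (block b) b b* (cong (_% r) (trans sum (reflection-sum≡2centre (block b)))))

    matchings-disjoint : ∀ j k a b → block a ≢ j → block a ≢ k → matched j a b ≡ true → matched k a b ≡ true → j ≡ k
    matchings-disjoint j k a b _ _ abj abk =
      trans (sym (blockOf-centre (nonempty j))) (trans (cong (blockOf x) centres≡) (blockOf-centre (nonempty k)))
      where
      centres≡ : centre j ≡ centre k
      centres≡ = double-cancel-% r r-odd (trans (sym (matched⇒ j a b abj)) (matched⇒ k a b abk))
                   (<r⇒<+r (centre j) (centre<r (nonempty k))) (<r⇒<+r (centre k) (centre<r (nonempty j)))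

-- Even r

module EvenConstruction {d′ n′ : ℕ} (x : Fin (suc d′) → ℕ) (sum≡r : sumFin x ≡ suc (suc n′))
                        (x-even : ∀ k → x k % 2 ≡ 0) (n-odd : suc n′ % 2 ≡ 1) (d′≤n : d′ ≤ suc n′) where

  n r : ℕ
  n = suc n′
  r = suc n
  open Layout x sum≡r

  ∞ : Fin r
  ∞ = zero

  j₀ : Fin (suc d′)
  j₀ = block ∞

  x≡2h : ∀ k → x k ≡ x k / 2 + x k / 2
  x≡2h k = begin
    x k                    ≡⟨ m≡m%n+[m/n]*n (x k) 2 ⟩
    x k % 2 + x k / 2 * 2  ≡⟨ cong (_+ x k / 2 * 2) (x-even k) ⟩
    x k / 2 * 2            ≡⟨ solve 1 (λ h → h :* con 2 := h :+ h) refl (x k / 2) ⟩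
    x k / 2 + x k / 2      ∎
    where open ≡-Reasoning

  module _ {k} (k-nonempty : x k ≢ 0) where

    1≤half : 1 ≤ x k / 2
    1≤half with x k / 2 in h≡
    ... | zero  = ⊥-elim (k-nonempty (trans (x≡2h k) (cong (λ h → h + h) h≡)))
    ... | suc _ = s≤s z≤n

    1+reflection-sum : suc (reflection-sum k) ≡ centre k + centre k
    1+reflection-sum = trans (cong (λ z → suc (start x k + start x k + (z ∸ 1))) (x≡2h k)) (shape (start x k) (x k / 2) 1≤half)
      where
      shape : ∀ s h → 1 ≤ h → suc (s + s + (h + h ∸ 1)) ≡ (s + h) + (s + h)
      shape s (suc h) _ = solve 2 (λ s h → con 1 :+ (s :+ s :+ (h :+ (con 1 :+ h))) := (s :+ (con 1 :+ h)) :+ (s :+ (con 1 :+ h))) refl s h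

    1≤centre : 1 ≤ centre k
    1≤centre = ≤-trans 1≤half (m≤n+m _ _)

  reflection-sum-injective : ∀ {j k} → x j ≢ 0 → x k ≢ 0 → reflection-sum j % n ≡ reflection-sum k % n → j ≡ k
  reflection-sum-injective {j} {k} j-ne k-ne Tj≡Tk =
    trans (sym (blockOf-centre j-ne)) (trans (cong (blockOf x) centres≡) (blockOf-centre k-ne))
    where
    centres≡ : centre j ≡ centre k
    centres≡ = double-cancel-% n n-odd
      (subst₂ (λ u v → u % n ≡ v % n) (1+reflection-sum j-ne) (1+reflection-sum k-ne) (%-cong-+ˡ n 1 Tj≡Tk))
      (≤-trans (centre<r k-ne) (+-monoˡ-≤ n (1≤centre j-ne)))
      (≤-trans (centre<r j-ne) (+-monoˡ-≤ n (1≤centre k-ne)))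

  block-nonempty : ∀ y → x (block y) ≢ 0
  block-nonempty y x≡0 with block-inside y
  ... | lo , hi = <⇒≱ (≤-trans hi (≤-reflexive (trans (cong (start x (block y) +_) x≡0) (+-identityʳ _)))) lo

  reflected : Fin r → Fin r
  reflected y = proj₁ (mirror y)

  reflected-block : ∀ y → block (reflected y) ≡ block y
  reflected-block y = proj₁ (proj₂ (mirror y))

  reflected-sum : ∀ y → toℕ y + toℕ (reflected y) ≡ reflection-sum (block y)
  reflected-sum y = proj₂ (proj₂ (mirror y))

  reflected-involutive : ∀ y → reflected (reflected y) ≡ y
  reflected-involutive y = toℕ-injective (+-cancelˡ-≡ (toℕ (reflected y)) _ _ (begin
    toℕ (reflected y) + toℕ (reflected (reflected y))  ≡⟨ reflected-sum (reflected y) ⟩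
    reflection-sum (block (reflected y))                ≡⟨ cong reflection-sum (reflected-block y) ⟩
    reflection-sum (block y)                            ≡⟨ reflected-sum y ⟨
    toℕ y + toℕ (reflected y)                           ≡⟨ +-comm (toℕ y) _ ⟩
    toℕ (reflected y) + toℕ y                           ∎))
    where open ≡-Reasoning

  -- Block lengths are even, so reflection sums are odd.
  reflected-≢ : ∀ y → reflected y ≢ y
  reflected-≢ y y*≡y = m+m≢1+n+n (centre (block y)) (toℕ y) (begin
    centre (block y) + centre (block y)   ≡⟨ 1+reflection-sum (block-nonempty y) ⟨
    suc (reflection-sum (block y))        ≡⟨ cong suc (reflected-sum y) ⟨
    suc (toℕ y + toℕ (reflected y))       ≡⟨ cong (λ z → suc (toℕ y + toℕ z)) y*≡y ⟩
    suc (toℕ y + toℕ y)                   ∎)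
    where open ≡-Reasoning

  -- The 1-factor of colour k ≠ j₀ is {a, b} with a + b ≡ τ k; a nonempty colour uses its reflection
  -- sum, the empty ones take distinct residues left over (there are enough since d ≤ r).
  Nonempty Empty : Fin (suc d′) → Bool
  Nonempty k = not (j₀ == k) ∧ not ⌊ x k ≟ℕ 0 ⌋
  Empty    k = not (j₀ == k) ∧ ⌊ x k ≟ℕ 0 ⌋

  Nonempty⇒ : ∀ k → Nonempty k ≡ true → j₀ ≢ k × x k ≢ 0
  Nonempty⇒ k nk = not==⇒≢ (∧-trueˡ (not (j₀ == k)) nk) , ⌊⌋-false⇒ (∧-trueʳ (not (j₀ == k)) nk)

  Empty⇒ : ∀ k → Empty k ≡ true → j₀ ≢ k × x k ≡ 0
  Empty⇒ k ek = not==⇒≢ (∧-trueˡ (not (j₀ == k)) ek) , ⌊⌋-true⇒ (∧-trueʳ (not (j₀ == k)) ek)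

  Nonempty⇐ : ∀ {k} → j₀ ≢ k → x k ≢ 0 → Nonempty k ≡ true
  Nonempty⇐ {k} k≢j₀ x≢0 = ∧-true (≢⇒not== k≢j₀) (cong not (⌊⌋-no (x k ≟ℕ 0) x≢0))

  Empty⇐ : ∀ {k} → j₀ ≢ k → x k ≡ 0 → Empty k ≡ true
  Empty⇐ {k} k≢j₀ x≡0 = ∧-true (≢⇒not== k≢j₀) (⌊⌋-yes (x k ≟ℕ 0) x≡0)

  residue : Fin (suc d′) → Fin n
  residue k = fromℕ< (m%n<n (reflection-sum k) n)

  residue-injective : InjectiveOn Nonempty residue
  residue-injective j k nj nk same = reflection-sum-injective (proj₂ (Nonempty⇒ j nj)) (proj₂ (Nonempty⇒ k nk))
    (trans (sym (toℕ-fromℕ< _)) (trans (cong toℕ same) (toℕ-fromℕ< _)))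

  free : Fin n → Bool
  free t = not (image Nonempty residue t)

  count-Empty≤count-free : count Empty ≤ count free
  count-Empty≤count-free = +-cancelʳ-≤ (count Nonempty) (count Empty) (count free) (begin
    count Empty + count Nonempty   ≡⟨ count-∨ Empty Nonempty disjoint ⟨
    count (λ k → Empty k ∨ Nonempty k) ≡⟨ count-cong split ⟩
    count (λ k → not (j₀ == k))    ≡⟨ count-not-== j₀ ⟩
    d′                             ≤⟨ d′≤n ⟩
    n                              ≡⟨ count-+-count-not (image Nonempty residue) ⟨
    count (image Nonempty residue) + count free ≡⟨ cong (_+ count free) (count-image Nonempty residue residue-injective) ⟩
    count Nonempty + count free    ≡⟨ +-comm (count Nonempty) (count free) ⟩
    count free + count Nonempty    ∎)
    where
    open ≤-Reasoning
    disjoint : ∀ k → Empty k ≡ true → Nonempty k ≡ true → ⊥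
    disjoint k ek nk = proj₂ (Nonempty⇒ k nk) (proj₂ (Empty⇒ k ek))
    split : ∀ k → (Empty k ∨ Nonempty k) ≡ not (j₀ == k)
    split k with j₀ == k | ⌊ x k ≟ℕ 0 ⌋
    ... | true  | true  = refl
    ... | true  | false = refl
    ... | false | true  = refl
    ... | false | false = refl

  private
    spare-injection : Σ (Fin (suc d′) → Fin n) λ f → MapsTo Empty free f × InjectiveOn Empty f
    spare-injection = injection-exists Empty free (λ _ → zero) count-Empty≤count-free

  spare≢residue : ∀ {j k} → j₀ ≢ j → x j ≡ 0 → j₀ ≢ k → x k ≢ 0 → proj₁ spare-injection j ≢ residue k
  spare≢residue {j} {k} j≢j₀ xj≡0 k≢j₀ xk≢0 same =
    true≢false (image-intro Nonempty residue k (Nonempty⇐ k≢j₀ xk≢0) (sym same))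
               (not-injective (proj₁ (proj₂ spare-injection) j (Empty⇐ j≢j₀ xj≡0)))

  τ : Fin (suc d′) → Fin n
  τ k with x k ≟ℕ 0
  ... | yes _ = proj₁ spare-injection k
  ... | no  _ = residue k

  τ-nonempty : ∀ k → x k ≢ 0 → toℕ (τ k) ≡ reflection-sum k % n
  τ-nonempty k x≢0 with x k ≟ℕ 0
  ... | yes x≡0 = ⊥-elim (x≢0 x≡0)
  ... | no  _   = toℕ-fromℕ< _

  τ-injective : ∀ {j k} → j₀ ≢ j → j₀ ≢ k → τ j ≡ τ k → j ≡ k
  τ-injective {j} {k} j≢j₀ k≢j₀ same with x j ≟ℕ 0 | x k ≟ℕ 0
  ... | yes xj≡0 | yes xk≡0 = proj₂ (proj₂ spare-injection) j k (Empty⇐ j≢j₀ xj≡0) (Empty⇐ k≢j₀ xk≡0) same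
  ... | yes xj≡0 | no  xk≢0 = ⊥-elim (spare≢residue j≢j₀ xj≡0 k≢j₀ xk≢0 same)
  ... | no  xj≢0 | yes xk≡0 = ⊥-elim (spare≢residue k≢j₀ xk≡0 j≢j₀ xj≢0 (sym same))
  ... | no  xj≢0 | no  xk≢0 = residue-injective j k (Nonempty⇐ j≢j₀ xj≢0) (Nonempty⇐ k≢j₀ xk≢0) same

  -- Modulo n, a pair {a, b} of finite points has sum a + b, and {∞, b} has sum 2b.
  pair-sum : Fin r → Fin r → ℕ
  pair-sum zero    b       = toℕ b + toℕ b
  pair-sum (suc a) zero    = suc (toℕ a) + suc (toℕ a)
  pair-sum (suc a) (suc b) = suc (toℕ a) + suc (toℕ b)

  pair-sum-comm : ∀ a b → pair-sum a b ≡ pair-sum b a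
  pair-sum-comm zero    zero    = refl
  pair-sum-comm zero    (suc b) = refl
  pair-sum-comm (suc a) zero    = refl
  pair-sum-comm (suc a) (suc b) = +-comm (suc (toℕ a)) (suc (toℕ b))

  pair-sum-finite : ∀ {a b} → a ≢ ∞ → b ≢ ∞ → pair-sum a b ≡ toℕ a + toℕ b
  pair-sum-finite {zero}  a≢∞ _   = ⊥-elim (a≢∞ refl)
  pair-sum-finite {suc a} {zero}  _ b≢∞ = ⊥-elim (b≢∞ refl)
  pair-sum-finite {suc a} {suc b} _ _   = refl

  private
    finite-close : ∀ (u v : Fin n) → suc (toℕ u) < suc (toℕ v) + n
    finite-close u v = s≤s (≤-trans (toℕ<n u) (m≤n+m n (toℕ v)))

  pair-sum-injective : ∀ a b b′ → a ≢ b → a ≢ b′ → pair-sum a b % n ≡ pair-sum a b′ % n → b ≡ b′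
  pair-sum-injective zero    zero    _        a≢b _    _ = ⊥-elim (a≢b refl)
  pair-sum-injective zero    (suc b) zero     _   a≢b′ _ = ⊥-elim (a≢b′ refl)
  pair-sum-injective zero    (suc b) (suc b′) _   _    e =
    toℕ-injective (double-cancel-% n n-odd e (finite-close b′ b) (finite-close b b′))
  pair-sum-injective (suc a) zero    zero     _   _    _ = refl
  pair-sum-injective (suc a) zero    (suc b′) _   a≢b′ e =
    ⊥-elim (a≢b′ (toℕ-injective (+-cancelˡ-% n (suc (toℕ a)) e (finite-close b′ a) (finite-close a b′))))
  pair-sum-injective (suc a) (suc b) zero     a≢b _    e =
    ⊥-elim (a≢b (toℕ-injective (+-cancelˡ-% n (suc (toℕ a)) (sym e) (finite-close b a) (finite-close a b))))
  pair-sum-injective (suc a) (suc b) (suc b′) _   _    e =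
    toℕ-injective (+-cancelˡ-% n (suc (toℕ a)) e (finite-close b′ b) (finite-close b b′))

  finite : ℕ → Fin r
  finite c = suc (fromℕ< (m%n<n (c + n′) n))

  finite-% : ∀ c → toℕ (finite c) % n ≡ c % n
  finite-% c = begin
    suc (toℕ (fromℕ< (m%n<n (c + n′) n))) % n  ≡⟨ cong (λ z → suc z % n) (toℕ-fromℕ< _) ⟩
    (1 + (c + n′) % n) % n                      ≡⟨ %-cong-+ˡ n 1 (m%n%n≡m%n (c + n′) n) ⟩
    (1 + (c + n′)) % n                          ≡⟨ cong (_% n) (+-suc c n′) ⟨
    (c + n) % n                                 ≡⟨ [m+n]%n≡m%n c n ⟩
    c % n                                       ∎
    where open ≡-Reasoning

  factor : Fin (suc d′) → Fin r → Fin r → Bool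
  factor k a b = not (a == b) ∧ ⌊ pair-sum a b % n ≟ℕ toℕ (τ k) ⌋

  factor⇒ : ∀ k a b → factor k a b ≡ true → a ≢ b × pair-sum a b % n ≡ toℕ (τ k)
  factor⇒ k a b e = not==⇒≢ (∧-trueˡ (not (a == b)) e) , ⌊⌋-true⇒ (∧-trueʳ (not (a == b)) e)

  factor⇐ : ∀ k a b → a ≢ b → pair-sum a b % n ≡ toℕ (τ k) → factor k a b ≡ true
  factor⇐ k a b a≢b sum = ∧-true (≢⇒not== a≢b) (⌊⌋-yes (_ ≟ℕ _) sum)

  factor-sym : ∀ k a b → factor k a b ≡ true → factor k b a ≡ true
  factor-sym k a b ab with factor⇒ k a b ab
  ... | a≢b , sum = factor⇐ k b a (λ b≡a → a≢b (sym b≡a)) (trans (cong (_% n) (pair-sum-comm b a)) sum)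

  factor-unique : ∀ k a b b′ → factor k a b ≡ true → factor k a b′ ≡ true → b ≡ b′
  factor-unique k a b b′ ab ab′ with factor⇒ k a b ab | factor⇒ k a b′ ab′
  ... | a≢b , sum | a≢b′ , sum′ = pair-sum-injective a b b′ a≢b a≢b′ (trans sum (sym sum′))

  τ-% : ∀ k → toℕ (τ k) % n ≡ toℕ (τ k)
  τ-% k = m<n⇒m%n≡m (toℕ<n (τ k))

  finite-solves : ∀ a c k → (a + c) % n ≡ toℕ (τ k) % n → (a + toℕ (finite c)) % n ≡ toℕ (τ k)
  finite-solves a c k a+c≡τ = trans (%-cong-+ˡ n a (finite-% c)) (trans a+c≡τ (τ-% k))

  factor-partner : ∀ k a → Σ (Fin r) λ b → factor k a b ≡ true
  factor-partner k zero with double-solve-% n n-odd (toℕ (τ k))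
  ... | c , 2c≡τ = finite c , factor⇐ k zero (finite c) (λ ())
                                (trans (%-cong-+ n {toℕ (finite c)} {c} {toℕ (finite c)} {c} (finite-% c) (finite-% c))
                                       (trans 2c≡τ (τ-% k)))
  factor-partner k (suc a) with +-solve-% n (suc (toℕ a)) (toℕ (τ k))
  ... | c , _ , a+c≡τ with finite c ≟ suc a
  ...   | yes c≡a = zero , factor⇐ k (suc a) zero (λ ())
                             (subst (λ z → (suc (toℕ a) + toℕ z) % n ≡ toℕ (τ k)) c≡a (finite-solves (suc (toℕ a)) c k a+c≡τ))
  ...   | no  c≢a = finite c , factor⇐ k (suc a) (finite c) (λ a≡c → c≢a (sym a≡c)) (finite-solves (suc (toℕ a)) c k a+c≡τ)

  finite-outside-j₀ : ∀ {a} → j₀ ≢ block a → a ≢ ∞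
  finite-outside-j₀ a∉j₀ a≡∞ = a∉j₀ (cong block (sym a≡∞))

  reflected-outside-j₀ : ∀ {a} → j₀ ≢ block a → j₀ ≢ block (reflected a)
  reflected-outside-j₀ {a} = subst (j₀ ≢_) (sym (reflected-block a))

  pair-sum-reflected : ∀ {a} → j₀ ≢ block a → pair-sum a (reflected a) ≡ reflection-sum (block a)
  pair-sum-reflected {a} a∉j₀ =
    trans (pair-sum-finite (finite-outside-j₀ a∉j₀) (finite-outside-j₀ (reflected-outside-j₀ a∉j₀))) (reflected-sum a)

  factor-reflected : ∀ b → j₀ ≢ block b → factor (block b) b (reflected b) ≡ true
  factor-reflected b b∉j₀ = factor⇐ (block b) b (reflected b) (λ b≡b* → reflected-≢ b (sym b≡b*)) (begin
    pair-sum b (reflected b) % n         ≡⟨ cong (_% n) (pair-sum-reflected b∉j₀) ⟩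
    reflection-sum (block b) % n         ≡⟨ τ-nonempty (block b) (block-nonempty b) ⟨
    toℕ (τ (block b))                    ∎)
    where open ≡-Reasoning

  factor-uncoloured : ∀ k a b → j₀ ≢ k → block a ≢ k → factor k a b ≡ true → block b ≢ k
  factor-uncoloured k a b k≢j₀ a∉k ab refl =
    a∉k (trans (cong block (factor-unique (block b) b a (reflected b) (factor-sym (block b) a b ab) (factor-reflected b k≢j₀)))
               (reflected-block b))

  reflection-pairs : Fin r → Fin r → Bool
  reflection-pairs a b = not (j₀ == block a) ∧ (reflected a == b)

  reflection-pairs⇒ : ∀ a b → reflection-pairs a b ≡ true → j₀ ≢ block a × reflected a ≡ b
  reflection-pairs⇒ a b e = not==⇒≢ (∧-trueˡ (not (j₀ == block a)) e) , ==⇒≡ (∧-trueʳ (not (j₀ == block a)) e)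

  reflection-pairs⇐ : ∀ a → j₀ ≢ block a → reflection-pairs a (reflected a) ≡ true
  reflection-pairs⇐ a a∉j₀ = ∧-true (≢⇒not== a∉j₀) (==-refl (reflected a))

  reflection-pairs-sym : ∀ a b → reflection-pairs a b ≡ true → reflection-pairs b a ≡ true
  reflection-pairs-sym a b ab with reflection-pairs⇒ a b ab
  ... | a∉j₀ , refl = subst (λ z → reflection-pairs (reflected a) z ≡ true) (reflected-involutive a)
                        (reflection-pairs⇐ (reflected a) (reflected-outside-j₀ a∉j₀))

  reflection-pairs-not-in-factor : ∀ k a b → j₀ ≢ k → block a ≢ k → reflection-pairs a b ≡ true → factor k a b ≡ true → ⊥
  reflection-pairs-not-in-factor k a b k≢j₀ a∉k ab-reflected ab-factor with reflection-pairs⇒ a b ab-reflected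
  ... | a∉j₀ , refl = a∉k (τ-injective a∉j₀ k≢j₀ (toℕ-injective (begin
    toℕ (τ (block a))                    ≡⟨ τ-nonempty (block a) (block-nonempty a) ⟩
    reflection-sum (block a) % n         ≡⟨ cong (_% n) (pair-sum-reflected a∉j₀) ⟨
    pair-sum a (reflected a) % n         ≡⟨ proj₂ (factor⇒ k a (reflected a) ab-factor) ⟩
    toℕ (τ k)                            ∎)))
    where open ≡-Reasoning

  matched : Fin (suc d′) → Fin r → Fin r → Bool
  matched j with j₀ ≟ j
  ... | yes _ = reflection-pairs
  ... | no  _ = factor j

  colourMatchings : ColourMatchings block
  colourMatchings = record
    { matched            = matched
    ; matched-sym        = matched-sym
    ; partner            = partner
    ; partner-unique     = partner-unique
    ; partner-≢          = partner-≢
    ; partner-uncoloured = partner-uncoloured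
    ; matchings-disjoint = matchings-disjoint
    }
    where
    matched-sym : ∀ j a b → matched j a b ≡ true → matched j b a ≡ true
    matched-sym j a b with j₀ ≟ j
    ... | yes _ = reflection-pairs-sym a b
    ... | no  _ = factor-sym j a b

    partner : ∀ j a → block a ≢ j → Σ (Fin r) λ b → matched j a b ≡ true
    partner j a a∉j with j₀ ≟ j
    ... | yes refl = reflected a , reflection-pairs⇐ a (λ j₀≡ → a∉j (sym j₀≡))
    ... | no  _    = factor-partner j a

    partner-unique : ∀ j a b b′ → block a ≢ j → matched j a b ≡ true → matched j a b′ ≡ true → b ≡ b′
    partner-unique j a b b′ _ ab ab′ with j₀ ≟ j
    ... | yes _ = trans (sym (proj₂ (reflection-pairs⇒ a b ab))) (proj₂ (reflection-pairs⇒ a b′ ab′))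
    ... | no  _ = factor-unique j a b b′ ab ab′

    partner-≢ : ∀ j a b → block a ≢ j → matched j a b ≡ true → b ≢ a
    partner-≢ j a b _ ab with j₀ ≟ j
    ... | yes _ = λ b≡a → reflected-≢ a (trans (proj₂ (reflection-pairs⇒ a b ab)) b≡a)
    ... | no  _ = λ b≡a → proj₁ (factor⇒ j a b ab) (sym b≡a)

    partner-uncoloured : ∀ j a b → block a ≢ j → matched j a b ≡ true → block b ≢ j
    partner-uncoloured j a b a∉j ab with j₀ ≟ j
    partner-uncoloured j a b a∉j ab | no j≢j₀ = factor-uncoloured j a b j≢j₀ a∉j ab
    partner-uncoloured j a b a∉j ab | yes refl with reflection-pairs⇒ a b ab
    ... | a∉j₀ , refl = λ b∈j₀ → a∉j₀ (sym (trans (sym (reflected-block a)) b∈j₀))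

    matchings-disjoint : ∀ j k a b → block a ≢ j → block a ≢ k → matched j a b ≡ true → matched k a b ≡ true → j ≡ k
    matchings-disjoint j k a b a∉j a∉k abj abk with j₀ ≟ j | j₀ ≟ k
    ... | yes refl | yes refl = refl
    ... | yes refl | no  k≢j₀ = ⊥-elim (reflection-pairs-not-in-factor k a b k≢j₀ a∉k abj abk)
    ... | no  j≢j₀ | yes refl = ⊥-elim (reflection-pairs-not-in-factor j a b j≢j₀ a∉j abk abj)
    ... | no  j≢j₀ | no  k≢j₀ =
      τ-injective j≢j₀ k≢j₀ (toℕ-injective (trans (sym (proj₂ (factor⇒ j a b abj))) (proj₂ (factor⇒ k a b abk))))

layout-matchings : ∀ {d′ r} (x : Fin (suc d′) → ℕ) (sum≡r : sumFin x ≡ r) → suc d′ ≤ r →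
                   (∀ i → x i % 2 ≡ r % 2) → ColourMatchings (Layout.block x sum≡r)
layout-matchings {r = suc r′} x sum≡r _ parities with parity (suc r′)
... | inj₂ r-odd = OddConstruction.colourMatchings x sum≡r (λ i → trans (parities i) r-odd) r-odd
layout-matchings {r = suc (suc n′)} x sum≡r (s≤s d′≤n) parities | inj₁ r-even =
  EvenConstruction.colourMatchings x sum≡r (λ i → trans (parities i) r-even) (even⇒suc-odd n′ r-even) d′≤n
layout-matchings {r = suc zero} x sum≡r _ parities | inj₁ ()

colourMatchings-exist : ∀ {d′ r} (x : Fin (suc d′) → ℕ) → sumFin x ≡ r → (p : Fin r → Fin (suc d′)) →
                        (∀ i → colourClassSize p i ≡ x i) → suc d′ ≤ r → (∀ i → x i % 2 ≡ r % 2) → ColourMatchings p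
colourMatchings-exist x sum≡r p sizes d≤r parities = ColourMatchings-relabel same-sizes (layout-matchings x sum≡r d≤r parities)
  where
  same-sizes : ∀ k → colourClassSize p k ≡ colourClassSize (Layout.block x sum≡r) k
  same-sizes k = trans (sizes k) (sym (Layout.block-size x sum≡r k))

theorem3p1 : (d r : ℕ) → 1 ≤ d → d ≤ r → (x : Fin d → ℕ) → sumFin x ≡ r →
  (p : Fin r → Fin d) → (∀ i → colourClassSize p i ≡ x i) →
  (Σ (SimpleGraph r) (λ G → Regular (d ∸ 1) G × SunColouring G p))
    ⇔ ((∀ i → x i % 2 ≡ r % 2) × (r % 2 ≡ 1 → d % 2 ≡ 1))
theorem3p1 zero     r ()
theorem3p1 (suc d′) r _ d≤r x sum≡r p sizes =
  mk⇔ (parity-conditions-necessary x sum≡r p sizes)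
      -- the condition on d is implied by the parities of the x i, whose sum is r
      (λ (parities , _) → sunColouring-from-matchings (colourMatchings-exist x sum≡r p sizes d≤r parities))
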